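{- In the Slow Flashcard Game, let $(V_t)_{t\ge1}$ be the viewing sequence and $(C_t)_{t\ge1}$ the counting sequence. Apply the Robinson–Schensted–Knuth row-insertion algorithm to a word with respect to the reversed total order $1\succ 2\succ 3\succ\cdots$ on the positive integers (so that when inserting a letter $x$ into a row, it bumps the leftmost entry that is $\succ x$), where the recording tableau receives the entry $s$ in the box created at the $s$-th insertion; rows are indexed from the top and columns from the left. Then for every $t\ge1$: (a) the recording tableau of $V_1V_2\cdots V_t$ consists exactly of the boxes $(i,j)$ (row $i$, column $j$) with $T_i(j)\le t$, and box $(i,j)$ contains $T_i(j)$; (b) the recording tableau of $C_1C_2\cdots C_t$ consists exactly of the boxes $(j,i)$ (row $j$, column $i$) with $T_i(j)\le t$, and box $(j,i)$ contains $T_i(j)$. Equivalently, the recording tableau for the viewing sequence is the tableau $\mathcal{T}$ whose box $(i,j)$ contains $T_i(j)$, and the recording tableau for the counting sequence is the transpose of $\mathcal{T}$.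
   Context: The Slow Flashcard Game is the following deterministic process with insertion sequence $p_k=k+1$. The state at each time $t=1,2,\dots$ consists of an ordering (the deck) of all positive integers (cards), positions numbered $1,2,\dots$ from the front, together with a counter for each card recording how many times it has been seen. At time $t=1$ the deck is $1,2,3,\dots$, card $1$ (at the front) has been seen once, and all other cards $0$ times. To pass from time $t$ to $t+1$: if the front card has been seen $k$ times so far, remove it and reinsert it so that it occupies position $k+1$; then the card now at the front has its counter increased by one (it is seen at time $t+1$). $T_n(k)$ is the time at which card $n$ is seen for the $k$-th time. The viewing sequence has $t$-th term $V_t$, the card seen at time $t$; the counting sequence has $t$-th term $C_t$, the number of times card $V_t$ has been seen up to and including time $t$. -}

module Defs where

open import Data.Nat.Base using (ℕ; zero; suc; _+_; _≤ᵇ_; _≡ᵇ_; _<ᵇ_)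
open import Data.Bool.Base using (if_then_else_)
open import Data.List.Base using (List; []; _∷_; _++_; [_]; applyUpTo)
open import Data.Maybe.Base using (Maybe; just; nothing)
open import Data.Product.Base using (_×_; _,_)

-- The Slow Flashcard Game with insertion sequence p_k = k + 1.
-- A deck is a function position ↦ card (positions 1,2,...; position 0
-- is unused).  A counter is a function card ↦ number of times seen.

record State : Set where
  constructor mkState
  field
    deck : ℕ → ℕ
    cnt  : ℕ → ℕ
open State public

initState : State
initState = mkState (λ i → i) (λ n → if n ≡ᵇ 1 then 1 else 0)

-- remove the front card c (seen k times) and reinsert it at position k+1
reinsert : (ℕ → ℕ) → ℕ → ℕ → (ℕ → ℕ)
reinsert d c k i =
  if i ≤ᵇ k then d (suc i)
  else (if i ≡ᵇ suc k then c else d i)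

step : State → State
step s = mkState d' cnt'
  where
    c    = deck s 1
    d'   = reinsert (deck s) c (cnt s c)
    c'   = d' 1
    cnt' = λ n → if n ≡ᵇ c' then suc (cnt s n) else cnt s n

-- stateAt t = state at time t (for t ≥ 1; stateAt 0 is unused junk = time 1)
stateAt : ℕ → State
stateAt zero = initState
stateAt (suc zero) = initState
stateAt (suc (suc t)) = step (stateAt (suc t))

V : ℕ → ℕ
V t = deck (stateAt t) 1

-- counting sequence C_t : times V_t has been seen up to and including time t
C : ℕ → ℕ
C t = cnt (stateAt t) (V t)

-- "T_n(k) = s" : card n is seen for the k-th time at time s
-- (i.e. V_s = n and C_s = k, with s ≥ 1)
open import Relation.Binary.PropositionalEquality using (_≡_)
open import Data.Nat.Base using (_≤_)

TIs : ℕ → ℕ → ℕ → Set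
TIs n k s = (1 ≤ s) × (V s ≡ n) × (C s ≡ k)

viewWord : ℕ → List ℕ
viewWord t = applyUpTo (λ s → V (suc s)) t

countWord : ℕ → List ℕ
countWord t = applyUpTo (λ s → C (suc s)) t

-- RSK row insertion w.r.t. the reversed order 1 ≻ 2 ≻ 3 ≻ ...
-- Inserting x into a row bumps the leftmost entry y with y ≻ x,
-- i.e. y < x numerically; otherwise x is appended at the end.

Tableau : Set
Tableau = List (List ℕ)

rowInsert : ℕ → List ℕ → List ℕ × Maybe ℕ
rowInsert x [] = [ x ] , nothing
rowInsert x (y ∷ ys) with y <ᵇ x
... | Data.Bool.Base.true  = (x ∷ ys) , just y
... | Data.Bool.Base.false with rowInsert x ys
...   | r , b = (y ∷ r) , b

-- insert into the insertion tableau; returns new tableau and the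
-- (0-based) index of the row in which a new box was created
insertP : ℕ → Tableau → Tableau × ℕ
insertP x [] = [ [ x ] ] , 0
insertP x (r ∷ rs) with rowInsert x r
... | r' , nothing = (r' ∷ rs) , 0
... | r' , just y with insertP y rs
...   | rs' , i = (r' ∷ rs') , suc i

addAt : ℕ → ℕ → Tableau → Tableau
addAt zero s [] = [ [ s ] ]
addAt zero s (r ∷ rs) = (r ++ [ s ]) ∷ rs
addAt (suc i) s [] = [] ∷ addAt i s []
addAt (suc i) s (r ∷ rs) = r ∷ addAt i s rs

rskFrom : ℕ → Tableau → Tableau → List ℕ → Tableau × Tableau
rskFrom s P Q [] = P , Q
rskFrom s P Q (x ∷ w) with insertP x P
... | P' , i = rskFrom (suc s) P' (addAt i s Q) w

recording : List ℕ → Tableau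
recording w with rskFrom 1 [] [] w
... | _ , Q = Q

-- entry of a tableau at (row i, column j), 1-indexed; nothing if no box
nth1 : {A : Set} → List A → ℕ → Maybe A
nth1 [] _ = nothing
nth1 (x ∷ xs) zero = nothing
nth1 (x ∷ xs) (suc zero) = just x
nth1 (x ∷ xs) (suc (suc n)) = nth1 xs (suc n)

entry : Tableau → ℕ → ℕ → Maybe ℕ
entry Q i j with nth1 Q i
... | nothing = nothing
... | just r = nth1 r j

-- Let c_n be the number of views of card n so far.  The deck keeps an invariant
-- (c_n decreases weakly in n, cards with equal counts lie in increasing order, and a card seen
-- c > 0 times lies among the first c + 1 positions) which forces the card n seen next to have
-- c_n < c_(n-1).  So (c_1, c_2, ...) stays a partition.  The insertion tableau of C_1 ⋯ C_t is then
-- the staircase of this partition, whose row r (from 0) lists the positive c_j − r, and that of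
-- V_1 ⋯ V_t is the staircase of the conjugate partition.  Inserting the next letter bumps one entry
-- per row and creates one box, at (c_n + 1, n) for C and at (n, c_n + 1) for V: exactly where the
-- recording tableau receives t + 1 = T_n(c_n + 1).

module Submission where

open import Defs
open import Data.Nat.Base using (ℕ; _≤_)
open import Data.Product.Base using (_×_)
open import Data.Maybe.Base using (just)
open import Relation.Binary.PropositionalEquality using (_≡_)
open import Function.Bundles using (_⇔_)

open import Data.Nat.Base
open import Data.Nat.Properties
open import Data.Bool.Base using (true; false; if_then_else_)
open import Data.Product.Base using (_,_; ∃; ∃₂; proj₁; proj₂)
open import Data.Sum.Base using (_⊎_; inj₁; inj₂)
open import Data.Empty using (⊥-elim)
open import Data.Maybe.Base using (Maybe; nothing)
open import Data.List.Base using (List; []; _∷_; _++_; [_]; map; length; applyUpTo; _∷ʳ_)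
open import Data.List.Properties using (++-identityʳ; length-++; applyUpTo-∷ʳ; length-applyUpTo)
open import Data.List.Relation.Unary.All as All using (All; []; _∷_)
open import Data.List.Relation.Unary.All.Properties using (++⁺; ++⁻ˡ; ++⁻ʳ; map⁺)
open import Relation.Nullary using (¬_; yes; no; contradiction)
open import Relation.Nullary.Decidable using (dec-true; dec-false)
open import Relation.Binary.PropositionalEquality hiding ([_])
open import Relation.Binary.Definitions using (tri<; tri≈; tri>)
open import Function.Base using (_∘_; flip)
open import Function.Bundles using (Equivalence; mk⇔)
open Equivalence using (to; from)
open import Function.Properties.Equivalence using () renaming (trans to ⇔-trans; sym to ⇔-sym)

≡ᵇ-true : ∀ {m n} → m ≡ n → (m ≡ᵇ n) ≡ true
≡ᵇ-true = dec-true (_ ≟ _)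

≡ᵇ-false : ∀ {m n} → m ≢ n → (m ≡ᵇ n) ≡ false
≡ᵇ-false = dec-false (_ ≟ _)

≤ᵇ-true : ∀ {m n} → m ≤ n → (m ≤ᵇ n) ≡ true
≤ᵇ-true = dec-true (_ ≤? _)

≤ᵇ-false : ∀ {m n} → ¬ m ≤ n → (m ≤ᵇ n) ≡ false
≤ᵇ-false = dec-false (_ ≤? _)

<ᵇ-true : ∀ {m n} → m < n → (m <ᵇ n) ≡ true
<ᵇ-true = dec-true (_ <? _)

<ᵇ-false : ∀ {m n} → n ≤ m → (m <ᵇ n) ≡ false
<ᵇ-false n≤m = dec-false (_ <? _) (≤⇒≯ n≤m)

module _ {A : Set} {x y : A} where

  if-true : ∀ {b} → b ≡ true → (if b then x else y) ≡ x
  if-true refl = refl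

  if-false : ∀ {b} → b ≡ false → (if b then x else y) ≡ y
  if-false refl = refl

-- The deck invariant

-- Reinserting the front card at position K + 1, in 0-based positions:
-- the card now at position i was at position o before.
data Source (K : ℕ) : ℕ → ℕ → Set where
  shifted : ∀ {i} → i < K → Source K i (suc i)
  moved   : Source K K 0
  kept    : ∀ {i} → K < i → Source K i i

source : ∀ K i → ∃ (Source K i)
source K i with <-cmp i K
... | tri< i<K _ _  = suc i , shifted i<K
... | tri≈ _ refl _ = 0 , moved
... | tri> _ _ K<i  = i , kept K<i

source⁻¹ : ∀ K o → ∃ λ i → Source K i o
source⁻¹ K zero = K , moved
source⁻¹ K (suc o) with o <? K
... | yes o<K = o , shifted o<K
... | no  o≮K = suc o , kept (s≤s (≮⇒≥ o≮K))

Source-injective : ∀ {K i j o} → Source K i o → Source K j o → i ≡ j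
Source-injective (shifted _)   (shifted _)    = refl
Source-injective (shifted i<K) (kept K<1+i)   = contradiction (s≤s⁻¹ K<1+i) (<⇒≱ i<K)
Source-injective moved         moved          = refl
Source-injective moved         (kept ())
Source-injective (kept K<1+j)  (shifted j<K)  = contradiction (s≤s⁻¹ K<1+j) (<⇒≱ j<K)
Source-injective (kept ())     moved
Source-injective (kept _)      (kept _)       = refl

reinsert-source : ∀ d K {i o} → Source K i o → reinsert d (d 1) K (suc i) ≡ d (suc o)
reinsert-source d K (shifted i<K) = if-true (≤ᵇ-true i<K)
reinsert-source d K moved         = trans (if-false (≤ᵇ-false (n≮n K))) (if-true (≡ᵇ-true {suc K} refl))
reinsert-source d K (kept K<i)    =
  trans (if-false (≤ᵇ-false (<-asym K<i))) (if-false (≡ᵇ-false (λ e → <-irrefl (sym (suc-injective e)) K<i)))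

-- Positions are 0-based: deck (suc i) is the card at position i + 1.
record DeckInvariant (deck count : ℕ → ℕ) : Set where
  field
    card-positive   : ∀ i → 1 ≤ deck (suc i)
    deck-injective  : ∀ i j → deck (suc i) ≡ deck (suc j) → i ≡ j
    deck-surjective : ∀ x → ∃ λ i → deck (suc i) ≡ suc x
    count-antitone  : ∀ a → count (suc (suc a)) ≤ count (suc a)
    ties-in-order   : ∀ i j → i < j → count (deck (suc j)) ≡ count (deck (suc i)) →
                      deck (suc i) < deck (suc j)
    position≤count  : ∀ i → 1 ≤ count (deck (suc i)) → i ≤ count (deck (suc i))

module DeckInvariantProperties {d p : ℕ → ℕ} (I : DeckInvariant d p) where
  open DeckInvariant I

  count-antitone-≤ : ∀ {a b} → a ≤ b → p (suc b) ≤ p (suc a)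
  count-antitone-≤ a≤b = go (≤⇒≤′ a≤b)
    where
      go : ∀ {a b} → a ≤′ b → p (suc b) ≤ p (suc a)
      go ≤′-refl        = ≤-refl
      go (≤′-step a≤′b) = ≤-trans (count-antitone _) (go a≤′b)

  fewer-views⇒later : ∀ {x y} → 1 ≤ x → p x < p y → y < x
  fewer-views⇒later {suc x} {zero}  _ _      = z<s
  fewer-views⇒later {suc x} {suc y} _ px<py with y <? x
  ... | yes y<x = s≤s y<x
  ... | no  y≮x = contradiction (count-antitone-≤ (≮⇒≥ y≮x)) (<⇒≱ px<py)

  front-drops : ∀ b → d 1 ≡ suc (suc b) → p (suc (suc b)) < p (suc b)
  front-drops b front≡ = ≤∧≢⇒< (count-antitone b) tie-impossible
    where
      tie-impossible : p (suc (suc b)) ≢ p (suc b)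
      tie-impossible tie with deck-surjective b
      ... | zero  , first≡ = 1+n≢n (trans (sym front≡) first≡)
      ... | suc i , at≡    = <-asym (subst₂ _<_ front≡ at≡ (ties-in-order 0 (suc i) z<s
                               (trans (cong p at≡) (trans (sym tie) (cong p (sym front≡))))))
                               (n<1+n (suc b))

-- p counts the views before the current view of the front card and p′ includes it,
-- so `step` reinserts the front card at position p′ (d 1) + 1.
module Reinsertion {d p p′ : ℕ → ℕ} (I : DeckInvariant d p)
  (p′-front : p′ (d 1) ≡ suc (p (d 1)))
  (p′-other : ∀ n → n ≢ d 1 → p′ n ≡ p n) where
  open DeckInvariant I
  open DeckInvariantProperties I

  K : ℕ
  K = p′ (d 1)

  d′ : ℕ → ℕ
  d′ = reinsert d (d 1) K

  card-source : ∀ {i o} → Source K i o → d′ (suc i) ≡ d (suc o)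
  card-source = reinsert-source d K

  count-source : ∀ {i o} → Source K i o → 0 < o → p′ (d′ (suc i)) ≡ p (d (suc o))
  count-source s 0<o =
    trans (cong p′ (card-source s)) (p′-other _ (λ e → <⇒≢ 0<o (sym (deck-injective _ 0 e))))

  count-moved : p′ (d′ (suc K)) ≡ K
  count-moved = cong p′ (card-source moved)

  p≤p′ : ∀ n → p n ≤ p′ n
  p≤p′ n with n ≟ d 1
  ... | yes refl = subst (p (d 1) ≤_) (sym p′-front) (n≤1+n _)
  ... | no  n≢f  = ≤-reflexive (sym (p′-other n n≢f))

  antitone : ∀ a → p′ (suc (suc a)) ≤ p′ (suc a)
  antitone a with suc (suc a) ≟ d 1
  ... | no  ≢front = begin
    p′ (suc (suc a)) ≡⟨ p′-other _ ≢front ⟩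
    p  (suc (suc a)) ≤⟨ count-antitone a ⟩
    p  (suc a)       ≤⟨ p≤p′ (suc a) ⟩
    p′ (suc a)       ∎
    where open ≤-Reasoning
  ... | yes ≡front = begin
    p′ (suc (suc a))    ≡⟨ cong p′ ≡front ⟩
    p′ (d 1)            ≡⟨ p′-front ⟩
    suc (p (d 1))       ≡⟨ cong (suc ∘ p) (sym ≡front) ⟩
    suc (p (suc (suc a))) ≤⟨ front-drops a (sym ≡front) ⟩
    p  (suc a)          ≡⟨ p′-other (suc a) (λ e → 1+n≢n (trans ≡front (sym e))) ⟨
    p′ (suc a)          ∎
    where open ≤-Reasoning

  untouched-ties : ∀ {i j oi oj} → Source K i oi → Source K j oj → 0 < oi → 0 < oj → oi < oj →
                   p′ (d′ (suc j)) ≡ p′ (d′ (suc i)) → d′ (suc i) < d′ (suc j)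
  untouched-ties si sj 0<oi 0<oj oi<oj tie =
    subst₂ _<_ (sym (card-source si)) (sym (card-source sj))
      (ties-in-order _ _ oi<oj (trans (sym (count-source sj 0<oj)) (trans tie (count-source si 0<oi))))

  ties : ∀ i j → i < j → p′ (d′ (suc j)) ≡ p′ (d′ (suc i)) → d′ (suc i) < d′ (suc j)
  ties i j i<j tie with source K i | source K j
  ... | _ , si@(shifted _)   | _ , sj@(shifted _) = untouched-ties si sj z<s z<s (s≤s i<j) tie
  ... | _ , si@(shifted i<K) | _ , sj@(kept K<j)  =
    untouched-ties si sj z<s (≤-trans z<s K<j) (≤-<-trans i<K K<j) tie
  ... | _ , si@(kept K<i)    | _ , sj@(kept _)    =
    untouched-ties si sj (≤-trans z<s K<i) (≤-trans z<s (<-trans K<i i<j)) i<j tie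
  ... | _ , kept K<i         | _ , shifted j<K    = contradiction j<K (<-asym (<-trans K<i i<j))
  ... | _ , kept K<i         | _ , moved          = contradiction i<j (<-asym K<i)
  ... | _ , moved            | _ , shifted j<K    = contradiction i<j (<-asym j<K)
  ... | _ , moved            | _ , moved          = contradiction i<j (n≮n K)
  ... | _ , moved            | _ , sj@(kept K<j)  =
    contradiction (position≤count j (subst (1 ≤_) (sym count≡K) (subst (1 ≤_) (sym p′-front) z<s)))
                  (<⇒≱ (subst (_< j) (sym count≡K) K<j))
    where
      count≡K : p (d (suc j)) ≡ K
      count≡K = trans (sym (count-source sj (≤-trans z<s K<j))) (trans tie count-moved)
  ... | _ , si@(shifted _)   | _ , moved          =
    subst₂ _<_ (sym (card-source si)) (sym (card-source moved))
      (fewer-views⇒later (card-positive 0) front<next)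
    where
      front<next : p (d 1) < p (d (suc (suc i)))
      front<next = subst (p (d 1) <_)
        (trans (sym p′-front) (trans (sym count-moved) (trans tie (count-source si z<s)))) ≤-refl

  position≤count′ : ∀ i → 1 ≤ p′ (d′ (suc i)) → i ≤ p′ (d′ (suc i))
  position≤count′ i 1≤ with source K i
  ... | _ , s@(shifted _) = subst (i ≤_) (sym c) (≤-trans (n≤1+n i) (position≤count (suc i) (subst (1 ≤_) c 1≤)))
    where c = count-source s z<s
  ... | _ , moved         = ≤-reflexive (sym count-moved)
  ... | _ , s@(kept K<i)  = subst (i ≤_) (sym c) (position≤count i (subst (1 ≤_) c 1≤))
    where c = count-source s (≤-trans z<s K<i)

  invariant : DeckInvariant d′ p′
  invariant = record
    { card-positive   = λ i → let o , s = source K i in subst (1 ≤_) (sym (card-source s)) (card-positive o)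
    ; deck-injective  = injective
    ; deck-surjective = λ x → let o , e = deck-surjective x ; i , s = source⁻¹ K o in
                              i , trans (card-source s) e
    ; count-antitone  = antitone
    ; ties-in-order   = ties
    ; position≤count  = position≤count′
    }
    where
      injective : ∀ i j → d′ (suc i) ≡ d′ (suc j) → i ≡ j
      injective i j e with source K i | source K j
      ... | oi , si | oj , sj with deck-injective oi oj (trans (sym (card-source si)) (trans e (card-source sj)))
      ...   | refl = Source-injective si sj

-- seen t n : the number of times card n is seen at times 1, …, t.
seen : ℕ → ℕ → ℕ
seen zero    _ = 0
seen (suc t) = cnt (stateAt (suc t))

seen-suc : ∀ t n → seen (suc t) n ≡ (if n ≡ᵇ V (suc t) then suc (seen t n) else seen t n)
seen-suc zero    n = refl
seen-suc (suc t) n = refl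

seen-viewed : ∀ t {n} → V (suc t) ≡ n → seen (suc t) n ≡ suc (seen t n)
seen-viewed t refl = trans (seen-suc t _) (if-true (≡ᵇ-true {V (suc t)} refl))

seen-other : ∀ t n → n ≢ V (suc t) → seen (suc t) n ≡ seen t n
seen-other t n n≢ = trans (seen-suc t n) (if-false (≡ᵇ-false n≢))

-- The deck at time t + 1, with the counts before the view at time t + 1.
deck-invariant : ∀ t → DeckInvariant (deck (stateAt (suc t))) (seen t)
deck-invariant zero = record
  { card-positive   = λ _ → z<s
  ; deck-injective  = λ _ _ → suc-injective
  ; deck-surjective = λ x → x , refl
  ; count-antitone  = λ _ → z≤n
  ; ties-in-order   = λ _ _ i<j _ → s≤s i<j
  ; position≤count  = λ _ ()
  }
deck-invariant (suc t) = Reinsertion.invariant (deck-invariant t) (seen-viewed t refl) (seen-other t)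

data DropsAt (f : ℕ → ℕ) : ℕ → Set where
  drops-at-zero : DropsAt f 0
  drops-at-suc  : ∀ {k} → f (suc k) < f k → DropsAt f (suc k)

DropsAt-cong : ∀ {f g} → (∀ j → f j ≡ g j) → ∀ {k} → DropsAt f k → DropsAt g k
DropsAt-cong f≗g drops-at-zero    = drops-at-zero
DropsAt-cong f≗g (drops-at-suc <) = drops-at-suc (subst₂ _<_ (f≗g _) (f≗g _) <)

DropsAt-≤ : ∀ {f k x n} → DropsAt f k → f k ≡ x → (∀ j → x < f j → j < n) → k ≤ n
DropsAt-≤ drops-at-zero     _     _       = z≤n
DropsAt-≤ (drops-at-suc f<) fk≡x x<f⇒j< = x<f⇒j< _ (subst (_< _) fk≡x f<)

DropsAt-below : ∀ {f} n → (∀ j → j < n → f n < f j) → DropsAt f n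
DropsAt-below zero    _      = drops-at-zero
DropsAt-below (suc n) below = drops-at-suc (below n (n<1+n n))

viewed-drops : ∀ t → ∃ λ a → V (suc t) ≡ suc a × DropsAt (λ j → seen t (suc j)) a
viewed-drops t with V (suc t) in front≡ | DeckInvariant.card-positive (deck-invariant t) 0
... | suc zero    | _ = 0 , refl , drops-at-zero
... | suc (suc b) | _ = suc b , refl ,
  drops-at-suc (DeckInvariantProperties.front-drops (deck-invariant t) b front≡)

-- Staircase tableaux

-- Partitions are lists; entries past the end read as 0 and updates past the end pad with 0.
infixl 9 _!_
_!_ : List ℕ → ℕ → ℕ
[]       ! _     = 0
(x ∷ xs) ! zero  = x
(x ∷ xs) ! suc j = xs ! j

_[_]≔_ : List ℕ → ℕ → ℕ → List ℕ
[]       [ zero  ]≔ v = [ v ]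
[]       [ suc k ]≔ v = 0 ∷ [] [ k ]≔ v
(x ∷ xs) [ zero  ]≔ v = v ∷ xs
(x ∷ xs) [ suc k ]≔ v = x ∷ xs [ k ]≔ v

!-≥length : ∀ xs {j} → length xs ≤ j → xs ! j ≡ 0
!-≥length []       _         = refl
!-≥length (x ∷ xs) (s≤s len≤) = !-≥length xs len≤

!-positive⇒<length : ∀ xs {j} → 0 < xs ! j → j < length xs
!-positive⇒<length xs {j} 0< with j <? length xs
... | yes j< = j<
... | no  j≮ = contradiction (!-≥length xs (≮⇒≥ j≮)) (<⇒≢ 0< ∘ sym)

All⇒! : ∀ {P : ℕ → Set} {xs j} → All P xs → j < length xs → P (xs ! j)
All⇒! {j = zero}  (px ∷ _)   _        = px
All⇒! {j = suc j} (_  ∷ pxs) (s≤s j<) = All⇒! pxs j<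

!⇒All : ∀ {P : ℕ → Set} xs → (∀ j → j < length xs → P (xs ! j)) → All P xs
!⇒All []       _  = []
!⇒All (x ∷ xs) Pj = Pj 0 z<s ∷ !⇒All xs (λ j j< → Pj (suc j) (s≤s j<))

!-++ˡ : ∀ xs {ys j} → j < length xs → (xs ++ ys) ! j ≡ xs ! j
!-++ˡ (x ∷ xs) {j = zero}  _        = refl
!-++ˡ (x ∷ xs) {j = suc j} (s≤s j<) = !-++ˡ xs j<

!-++ʳ : ∀ xs {ys} j → (xs ++ ys) ! (length xs + j) ≡ ys ! j
!-++ʳ []       j = refl
!-++ʳ (x ∷ xs) j = !-++ʳ xs j

[]≔-! : ∀ xs k v → (xs [ k ]≔ v) ! k ≡ v
[]≔-! []       zero    v = refl
[]≔-! []       (suc k) v = []≔-! [] k v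
[]≔-! (x ∷ xs) zero    v = refl
[]≔-! (x ∷ xs) (suc k) v = []≔-! xs k v

[]≔-!-other : ∀ xs k v j → j ≢ k → (xs [ k ]≔ v) ! j ≡ xs ! j
[]≔-!-other []       zero    v zero    j≢k = contradiction refl j≢k
[]≔-!-other []       zero    v (suc j) _   = refl
[]≔-!-other []       (suc k) v zero    _   = refl
[]≔-!-other []       (suc k) v (suc j) j≢k = []≔-!-other [] k v j (j≢k ∘ cong suc)
[]≔-!-other (x ∷ xs) zero    v zero    j≢k = contradiction refl j≢k
[]≔-!-other (x ∷ xs) zero    v (suc j) _   = refl
[]≔-!-other (x ∷ xs) (suc k) v zero    _   = refl
[]≔-!-other (x ∷ xs) (suc k) v (suc j) j≢k = []≔-!-other xs k v j (j≢k ∘ cong suc)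

[]≔-All : ∀ {P : ℕ → Set} {xs k v} → k ≤ length xs → P v → All P xs → All P (xs [ k ]≔ v)
[]≔-All {xs = []}     {zero}  _        pv []         = pv ∷ []
[]≔-All {xs = x ∷ xs} {zero}  _        pv (_ ∷ pxs)  = pv ∷ pxs
[]≔-All {xs = x ∷ xs} {suc k} (s≤s k≤) pv (px ∷ pxs) = px ∷ []≔-All k≤ pv pxs

[]≔-length : ∀ xs v → xs [ length xs ]≔ v ≡ xs ++ [ v ]
[]≔-length []       v = refl
[]≔-length (x ∷ xs) v = cong (x ∷_) ([]≔-length xs v)

[]≔-middle : ∀ xs {y ys} v → (xs ++ y ∷ ys) [ length xs ]≔ v ≡ xs ++ v ∷ ys
[]≔-middle []       v = refl
[]≔-middle (x ∷ xs) v = cong (x ∷_) ([]≔-middle xs v)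

split-at : ∀ xs k {y} → xs ! k ≡ suc y → ∃₂ λ pre post → xs ≡ pre ++ suc y ∷ post × length pre ≡ k
split-at (x ∷ xs) zero    refl = [] , xs , refl , refl
split-at (x ∷ xs) (suc k) xk≡ with split-at xs k xk≡
... | pre , post , refl , refl = x ∷ pre , post , refl , refl

lower : List ℕ → List ℕ
lower []                 = []
lower (suc (suc y) ∷ ys) = suc y ∷ lower ys
lower (_ ∷ ys)           = lower ys

-- Row r of staircase F h lists h ! j ∸ r over the j with r < h ! j;
-- F is fuel, enough when it bounds the entries of h.
staircase : ℕ → List ℕ → Tableau
staircase zero    _        = []
staircase (suc F) []       = []
staircase (suc F) (y ∷ ys) = (y ∷ ys) ∷ staircase F (lower (y ∷ ys))

lower-++ : ∀ xs ys → lower (xs ++ ys) ≡ lower xs ++ lower ys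
lower-++ []                 ys = refl
lower-++ (zero ∷ xs)        ys = lower-++ xs ys
lower-++ (suc zero ∷ xs)    ys = lower-++ xs ys
lower-++ (suc (suc x) ∷ xs) ys = cong (suc x ∷_) (lower-++ xs ys)

lower-≥2 : ∀ {xs} → All (2 ≤_) xs → lower xs ≡ map pred xs
lower-≥2 []                   = refl
lower-≥2 (s≤s (s≤s _) ∷ 2≤xs) = cong (_ ∷_) (lower-≥2 2≤xs)

lower-≤1 : ∀ {xs} → All (_≤ 1) xs → lower xs ≡ []
lower-≤1 []              = refl
lower-≤1 (z≤n ∷ ≤1)      = lower-≤1 ≤1
lower-≤1 (s≤s z≤n ∷ ≤1)  = lower-≤1 ≤1

lower-positive : ∀ xs → All (1 ≤_) (lower xs)
lower-positive []                 = []
lower-positive (zero ∷ xs)        = lower-positive xs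
lower-positive (suc zero ∷ xs)    = lower-positive xs
lower-positive (suc (suc x) ∷ xs) = z<s ∷ lower-positive xs

lower-bounded : ∀ {F xs} → All (_≤ suc F) xs → All (_≤ F) (lower xs)
lower-bounded []                       = []
lower-bounded {xs = zero ∷ _}        (_ ∷ ≤F) = lower-bounded ≤F
lower-bounded {xs = suc zero ∷ _}    (_ ∷ ≤F) = lower-bounded ≤F
lower-bounded {xs = suc (suc _) ∷ _} (s≤s x≤F ∷ ≤F) = x≤F ∷ lower-bounded ≤F

lower-middle : ∀ pre {y post} → All (2 ≤_) pre → lower (pre ++ y ∷ post) ≡ map pred pre ++ lower (y ∷ post)
lower-middle pre {y} {post} 2≤pre =
  trans (lower-++ pre (y ∷ post)) (cong (_++ lower (y ∷ post)) (lower-≥2 2≤pre))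

staircase-[] : ∀ F → staircase F [] ≡ []
staircase-[] zero    = refl
staircase-[] (suc F) = refl

staircase-fuel : ∀ F e {h} → All (1 ≤_) h → All (_≤ F) h → staircase F h ≡ staircase (F + e) h
staircase-fuel zero    e {[]}    _           _          = sym (staircase-[] e)
staircase-fuel zero    e {y ∷ h} (1≤y ∷ _)   (y≤0 ∷ _)  = contradiction y≤0 (<⇒≱ 1≤y)
staircase-fuel (suc F) e {[]}    _           _          = refl
staircase-fuel (suc F) e {y ∷ h} _           ≤F         =
  cong ((y ∷ h) ∷_) (staircase-fuel F e (lower-positive (y ∷ h)) (lower-bounded ≤F))

staircase-++ : ∀ F pre {y post} →
  staircase (suc F) (pre ++ y ∷ post) ≡ (pre ++ y ∷ post) ∷ staircase F (lower (pre ++ y ∷ post))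
staircase-++ F []      = refl
staircase-++ F (_ ∷ _) = refl

rowInsert-append : ∀ {row} → All (1 ≤_) row → rowInsert 1 row ≡ (row ++ [ 1 ] , nothing)
rowInsert-append []                        = refl
rowInsert-append {z ∷ zs} (1≤z ∷ 1≤zs)
  rewrite <ᵇ-false 1≤z | rowInsert-append 1≤zs = refl

rowInsert-bump : ∀ {x y} pre post → All (x ≤_) pre → y < x →
  rowInsert x (pre ++ y ∷ post) ≡ (pre ++ x ∷ post , just y)
rowInsert-bump []       post []          y<x rewrite <ᵇ-true y<x = refl
rowInsert-bump (z ∷ zs) post (x≤z ∷ x≤zs) y<x
  rewrite <ᵇ-false x≤z | rowInsert-bump zs post x≤zs y<x = refl

insertP-settled : ∀ {x row row′} rows → rowInsert x row ≡ (row′ , nothing) →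
  insertP x (row ∷ rows) ≡ (row′ ∷ rows , 0)
insertP-settled rows eq rewrite eq = refl

insertP-bumped : ∀ {x y row row′} rows → rowInsert x row ≡ (row′ , just y) →
  insertP x (row ∷ rows) ≡ (row′ ∷ proj₁ (insertP y rows) , suc (proj₂ (insertP y rows)))
insertP-bumped {y = y} rows eq rewrite eq with insertP y rows
... | _ = refl

map-pred-All : ∀ {n xs} → All (suc n ≤_) xs → All (n ≤_) (map pred xs)
map-pred-All 1+n≤xs = map⁺ (All.map pred-mono-≤ 1+n≤xs)

staircase-append : ∀ F {h} → All (1 ≤_) h → insertP 1 (staircase (suc F) h) ≡ (staircase (suc F) (h ++ [ 1 ]) , 0)
staircase-append F {[]}    _   = cong (λ rows → ([ 1 ] ∷ rows) , 0) (sym (staircase-[] F))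
staircase-append F {y ∷ h} 1≤h
  rewrite insertP-settled (staircase F (lower (y ∷ h))) (rowInsert-append 1≤h)
        | lower-++ (y ∷ h) [ 1 ] | ++-identityʳ (lower (y ∷ h)) = refl

-- Each row r ≤ x of the staircase bumps its entry x + 1 − r (replacing it by x + 2 − r),
-- and the bumped 1 is appended to row x + 1.
insert-bump : ∀ x F pre post → All (suc (suc x) ≤_) pre → All (_≤ suc x) post → All (1 ≤_) post →
  All (_≤ F) (pre ++ suc (suc x) ∷ post) →
  insertP (suc (suc x)) (staircase F (pre ++ suc x ∷ post)) ≡ (staircase F (pre ++ suc (suc x) ∷ post) , suc x)
insert-bump-lower : ∀ x F pre post → All (suc (suc x) ≤_) pre → All (_≤ suc x) post → All (1 ≤_) post →
  All (_≤ suc F) (pre ++ suc (suc x) ∷ post) →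
  insertP (suc x) (staircase F (lower (pre ++ suc x ∷ post)))
    ≡ (staircase F (lower (pre ++ suc (suc x) ∷ post)) , x)

insert-bump x zero pre post _ _ _ ≤0 with ++⁻ʳ pre ≤0
... | () ∷ _
insert-bump x (suc F) pre post above below 1≤post ≤F = begin
  insertP X (staircase (suc F) (pre ++ Y ∷ post))
    ≡⟨ cong (insertP X) (staircase-++ F pre) ⟩
  insertP X ((pre ++ Y ∷ post) ∷ staircase F (lower (pre ++ Y ∷ post)))
    ≡⟨ insertP-bumped {row = pre ++ Y ∷ post} _ (rowInsert-bump pre post above (n<1+n Y)) ⟩
  ((pre ++ X ∷ post) ∷ proj₁ (insertP Y (staircase F (lower (pre ++ Y ∷ post)))) ,
     suc (proj₂ (insertP Y (staircase F (lower (pre ++ Y ∷ post))))))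
    ≡⟨ cong (λ (P , r) → (pre ++ X ∷ post) ∷ P , suc r)
            (insert-bump-lower x F pre post above below 1≤post ≤F) ⟩
  ((pre ++ X ∷ post) ∷ staircase F (lower (pre ++ X ∷ post)) , suc x)
    ≡⟨ cong (_, suc x) (staircase-++ F pre) ⟨
  (staircase (suc F) (pre ++ X ∷ post) , suc x) ∎
  where
    open ≡-Reasoning
    X = suc (suc x)
    Y = suc x

insert-bump-lower zero zero pre post _ _ _ ≤1 with ++⁻ʳ pre ≤1
... | s≤s () ∷ _
insert-bump-lower zero (suc F) pre post above below _ ≤F = begin
  insertP 1 (staircase (suc F) (lower (pre ++ 1 ∷ post)))
    ≡⟨ cong (λ h → insertP 1 (staircase (suc F) h)) (trans (lower-short 1) (++-identityʳ _)) ⟩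
  insertP 1 (staircase (suc F) (map pred pre))
    ≡⟨ staircase-append F (map-pred-All above) ⟩
  (staircase (suc F) (map pred pre ++ [ 1 ]) , 0)
    ≡⟨ cong (λ h → staircase (suc F) h , 0) (lower-short 2) ⟨
  (staircase (suc F) (lower (pre ++ 2 ∷ post)) , 0) ∎
  where
    open ≡-Reasoning
    lower-short : ∀ y → lower (pre ++ y ∷ post) ≡ map pred pre ++ lower [ y ]
    lower-short y = begin
      lower (pre ++ y ∷ post)          ≡⟨ lower-middle pre above ⟩
      map pred pre ++ lower (y ∷ post) ≡⟨ cong (map pred pre ++_) (lower-++ [ y ] post) ⟩
      map pred pre ++ (lower [ y ] ++ lower post)
        ≡⟨ cong (λ l → map pred pre ++ (lower [ y ] ++ l)) (lower-≤1 below) ⟩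
      map pred pre ++ (lower [ y ] ++ []) ≡⟨ cong (map pred pre ++_) (++-identityʳ _) ⟩
      map pred pre ++ lower [ y ] ∎
insert-bump-lower (suc x) F pre post above below 1≤post ≤F = begin
  insertP (suc (suc x)) (staircase F (lower (pre ++ suc (suc x) ∷ post)))
    ≡⟨ cong (λ h → insertP (suc (suc x)) (staircase F h)) (lower-middle pre 2≤pre) ⟩
  insertP (suc (suc x)) (staircase F (map pred pre ++ suc x ∷ lower post))
    ≡⟨ insert-bump x F (map pred pre) (lower post) (map-pred-All above) (lower-bounded below)
         (lower-positive post) (subst (All (_≤ F)) (lower-middle pre 2≤pre) (lower-bounded ≤F)) ⟩
  (staircase F (map pred pre ++ suc (suc x) ∷ lower post) , suc x)
    ≡⟨ cong (λ h → staircase F h , suc x) (lower-middle pre 2≤pre) ⟨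
  (staircase F (lower (pre ++ suc (suc (suc x)) ∷ post)) , suc x) ∎
  where
    open ≡-Reasoning
    2≤pre : All (2 ≤_) pre
    2≤pre = All.map (≤-trans (s≤s (s≤s z≤n))) above

exceeding-within : ∀ h {k x} → (∀ i → x < h ! i ⇔ i < k) → k ≤ length h
exceeding-within h {zero}  exceeds = z≤n
exceeding-within h {suc k} exceeds = !-positive⇒<length h (≤-trans z<s (from (exceeds k) (n<1+n k)))

-- Inserting x + 1 raises the leftmost entry x of h to x + 1; the new box ends row x.
insert-staircase : ∀ F h k x → All (1 ≤_) h → All (_≤ F) h → h ! k ≡ x → (∀ i → x < h ! i ⇔ i < k) →
  insertP (suc x) (staircase F h) ≡ (staircase (F + suc x) (h [ k ]≔ suc x) , x)
insert-staircase F h k zero 1≤h ≤F hk≡0 exceeds = begin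
  insertP 1 (staircase F h)            ≡⟨ cong (insertP 1) (staircase-fuel F 1 1≤h ≤F) ⟩
  insertP 1 (staircase (F + 1) h)      ≡⟨ cong (λ G → insertP 1 (staircase G h)) (+-comm F 1) ⟩
  insertP 1 (staircase (suc F) h)      ≡⟨ staircase-append F 1≤h ⟩
  (staircase (suc F) (h ++ [ 1 ]) , 0) ≡⟨ cong (λ G → staircase G (h ++ [ 1 ]) , 0) (+-comm 1 F) ⟩
  (staircase (F + 1) (h ++ [ 1 ]) , 0) ≡⟨ cong (λ h′ → staircase (F + 1) h′ , 0) (sym ([]≔-length h 1)) ⟩
  (staircase (F + 1) (h [ length h ]≔ 1) , 0) ≡⟨ cong (λ l → staircase (F + 1) (h [ l ]≔ 1) , 0) k≡ ⟩
  (staircase (F + 1) (h [ k ]≔ 1) , 0) ∎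
  where
    open ≡-Reasoning
    length≤k : length h ≤ k
    length≤k with k <? length h
    ... | yes k< = contradiction hk≡0 (<⇒≢ (All⇒! 1≤h k<) ∘ sym)
    ... | no  k≮ = ≮⇒≥ k≮
    k≡ : length h ≡ k
    k≡ = ≤-antisym length≤k (exceeding-within h exceeds)
insert-staircase F h k (suc x) 1≤h ≤F hk≡ exceeds with split-at h k hk≡
... | pre , post , refl , refl = begin
  insertP X (staircase F (pre ++ suc x ∷ post))  ≡⟨ cong (insertP X) (staircase-fuel F X 1≤h ≤F) ⟩
  insertP X (staircase F′ (pre ++ suc x ∷ post)) ≡⟨ insert-bump x F′ pre post above below 1≤post ≤F′ ⟩
  (staircase F′ (pre ++ X ∷ post) , suc x)
    ≡⟨ cong (λ h′ → staircase F′ h′ , suc x) ([]≔-middle pre X) ⟨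
  (staircase F′ ((pre ++ suc x ∷ post) [ length pre ]≔ X) , suc x) ∎
  where
    open ≡-Reasoning
    X  = suc (suc x)
    F′ = F + X
    above : All (X ≤_) pre
    above = !⇒All pre λ i i< → subst (suc x <_) (!-++ˡ pre i<) (from (exceeds i) i<)
    below : All (_≤ suc x) post
    below = !⇒All post λ i _ → ≮⇒≥ λ x<post →
      m+n≮m (length pre) (suc i)
        (to (exceeds (length pre + suc i)) (subst (suc x <_) (sym (!-++ʳ pre (suc i))) x<post))
    1≤post : All (1 ≤_) post
    1≤post with ++⁻ʳ pre 1≤h
    ... | _ ∷ 1≤post = 1≤post
    ≤F′ : All (_≤ F′) (pre ++ X ∷ post)
    ≤F′ with ++⁻ʳ pre ≤F
    ... | _ ∷ post≤F = ++⁺ (All.map (λ ≤F → ≤-trans ≤F (m≤m+n F X)) (++⁻ˡ pre ≤F))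
                           (m≤n+m X F ∷ All.map (λ ≤F → ≤-trans ≤F (m≤m+n F X)) post≤F)

-- Recording tableaux

rowAt : Tableau → ℕ → List ℕ
rowAt []       _       = []
rowAt (q ∷ Q) zero    = q
rowAt (q ∷ Q) (suc r) = rowAt Q r

rowLength : Tableau → ℕ → ℕ
rowLength Q r = length (rowAt Q r)

-- Box (r, j) with 0-based indices.
box : Tableau → ℕ → ℕ → Maybe ℕ
box Q r j = nth1 (rowAt Q r) (suc j)

entry-box : ∀ Q r j → entry Q (suc r) (suc j) ≡ box Q r j
entry-box []      r       j = refl
entry-box (q ∷ Q) zero    j = refl
entry-box (q ∷ Q) (suc r) j with nth1 Q (suc r) | entry-box Q r j
... | nothing | e = e
... | just _  | e = e

rowAt-addAt : ∀ r s Q → rowAt (addAt r s Q) r ≡ rowAt Q r ++ [ s ]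
rowAt-addAt zero    s []      = refl
rowAt-addAt zero    s (q ∷ Q) = refl
rowAt-addAt (suc r) s []      = rowAt-addAt r s []
rowAt-addAt (suc r) s (q ∷ Q) = rowAt-addAt r s Q

rowAt-addAt-other : ∀ r s Q r′ → r′ ≢ r → rowAt (addAt r s Q) r′ ≡ rowAt Q r′
rowAt-addAt-other zero    s []      zero     r′≢r = contradiction refl r′≢r
rowAt-addAt-other zero    s []      (suc r′) _    = refl
rowAt-addAt-other zero    s (q ∷ Q) zero     r′≢r = contradiction refl r′≢r
rowAt-addAt-other zero    s (q ∷ Q) (suc r′) _    = refl
rowAt-addAt-other (suc r) s []      zero     _    = refl
rowAt-addAt-other (suc r) s []      (suc r′) r′≢r = rowAt-addAt-other r s [] r′ (r′≢r ∘ cong suc)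
rowAt-addAt-other (suc r) s (q ∷ Q) zero     _    = refl
rowAt-addAt-other (suc r) s (q ∷ Q) (suc r′) r′≢r = rowAt-addAt-other r s Q r′ (r′≢r ∘ cong suc)

nth1-<length : ∀ (xs : List ℕ) j {v} → nth1 xs (suc j) ≡ just v → j < length xs
nth1-<length (x ∷ xs) zero    _ = z<s
nth1-<length (x ∷ xs) (suc j) e = s≤s (nth1-<length xs j e)

nth1-++ˡ : ∀ (xs : List ℕ) {s j} → j < length xs → nth1 (xs ++ [ s ]) (suc j) ≡ nth1 xs (suc j)
nth1-++ˡ (x ∷ xs) {j = zero}  _        = refl
nth1-++ˡ (x ∷ xs) {j = suc j} (s≤s j<) = nth1-++ˡ xs j<

nth1-++-length : ∀ (xs : List ℕ) s → nth1 (xs ++ [ s ]) (suc (length xs)) ≡ just s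
nth1-++-length []       s = refl
nth1-++-length (x ∷ xs) s = nth1-++-length xs s

nth1-++ʳ : ∀ (xs : List ℕ) {s j} → length xs < j → nth1 (xs ++ [ s ]) (suc j) ≡ nothing
nth1-++ʳ []       {j = suc j} _        = refl
nth1-++ʳ (x ∷ xs) {j = suc j} (s≤s <j) = nth1-++ʳ xs <j

<suc⇔< : ∀ {a b} → a ≢ b → (a < suc b ⇔ a < b)
<suc⇔< a≢b = mk⇔ (λ a<1+b → ≤∧≢⇒< (s≤s⁻¹ a<1+b) a≢b) m<n⇒m<1+n

AddBox : (ℕ → ℕ → ℕ → Set) → ℕ → ℕ → ℕ → ℕ → ℕ → ℕ → Set
AddBox R i j v i′ j′ v′ = R i′ j′ v′ ⊎ (i′ ≡ i × j′ ≡ j × v′ ≡ v)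

-- h lists the column lengths of Q; the tableaux are indexed from 0 and R from 1.
record RSKInvariant (h : List ℕ) (R : ℕ → ℕ → ℕ → Set) (PQ : Tableau × Tableau) : Set where
  field
    fuel        : ℕ
    fuel-bound  : All (_≤ fuel) h
    h-positive  : All (1 ≤_) h
    P-staircase : proj₁ PQ ≡ staircase fuel h
    Q-shape     : ∀ r j → j < rowLength (proj₂ PQ) r ⇔ r < h ! j
    Q-boxes     : ∀ r j v → box (proj₂ PQ) r j ≡ just v ⇔ R (suc r) (suc j) v

rskStep : ℕ → Tableau × Tableau → ℕ → Tableau × Tableau
rskStep s (P , Q) x = proj₁ (insertP x P) , addAt (proj₂ (insertP x P)) s Q

module InsertStep {h R P Q} (I : RSKInvariant h R (P , Q))
                  {k x} (hk≡x : h ! k ≡ x) (drops : DropsAt (h !_) k) where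
  open RSKInvariant I

  row-length : rowLength Q x ≡ k
  row-length = ≤-antisym ≤k k≤
    where
      ≤k : rowLength Q x ≤ k
      ≤k with k <? rowLength Q x
      ... | yes k< = contradiction (to (Q-shape x k) k<) (<-irrefl (sym hk≡x))
      ... | no  k≮ = ≮⇒≥ k≮
      k≤ : k ≤ rowLength Q x
      k≤ = DropsAt-≤ drops hk≡x (λ j → from (Q-shape x j))

  exceeds : ∀ i → x < h ! i ⇔ i < k
  exceeds i = subst (λ l → x < h ! i ⇔ i < l) row-length (⇔-sym (Q-shape x i))

  h′ : List ℕ
  h′ = h [ k ]≔ suc x

  insertion : insertP (suc x) P ≡ (staircase (fuel + suc x) h′ , x)
  insertion = trans (cong (insertP (suc x)) P-staircase)
                    (insert-staircase fuel h k x h-positive fuel-bound hk≡x exceeds)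

  inserted-row : proj₂ (insertP (suc x) P) ≡ x
  inserted-row = cong proj₂ insertion

  module _ (s : ℕ) where
    Q′ : Tableau
    Q′ = addAt x s Q

    row-length-x : rowLength Q′ x ≡ suc k
    row-length-x = trans (cong length (rowAt-addAt x s Q))
                         (trans (length-++ (rowAt Q x)) (trans (+-comm _ 1) (cong suc row-length)))

    row-length-other : ∀ {r} → r ≢ x → rowLength Q′ r ≡ rowLength Q r
    row-length-other r≢x = cong length (rowAt-addAt-other x s Q _ r≢x)

    reshape : ∀ {r j l m} → rowLength Q′ r ≡ l → h′ ! j ≡ m → (j < l ⇔ r < m) → (j < rowLength Q′ r ⇔ r < h′ ! j)
    reshape refl refl j<l⇔r<m = j<l⇔r<m

    shape : ∀ r j → j < rowLength Q′ r ⇔ r < h′ ! j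
    shape r j with r ≟ x | j ≟ k
    ... | yes refl | yes refl = reshape row-length-x ([]≔-! h k (suc x)) (mk⇔ (λ _ → n<1+n r) (λ _ → n<1+n k))
    ... | yes refl | no  j≢k  = reshape row-length-x ([]≔-!-other h k (suc x) j j≢k)
                                  (⇔-trans (<suc⇔< j≢k) (⇔-sym (exceeds j)))
    ... | no  r≢x  | yes refl = reshape (row-length-other r≢x) ([]≔-! h k (suc x))
                                  (⇔-trans (Q-shape r j)
                                    (subst (λ m → r < m ⇔ r < suc x) (sym hk≡x) (⇔-sym (<suc⇔< r≢x))))
    ... | no  r≢x  | no  j≢k  = reshape (row-length-other r≢x) ([]≔-!-other h k (suc x) j j≢k) (Q-shape r j)

    R′ : ℕ → ℕ → ℕ → Set
    R′ = AddBox R (suc x) (suc k) s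

    boxes : ∀ r j v → box Q′ r j ≡ just v ⇔ R′ (suc r) (suc j) v
    boxes r j v with r ≟ x
    ... | no r≢x = subst (λ row → nth1 row (suc j) ≡ just v ⇔ R′ (suc r) (suc j) v)
                     (sym (rowAt-addAt-other x s Q r r≢x))
                     (mk⇔ (inj₁ ∘ to (Q-boxes r j v)) old)
      where
        old : R′ (suc r) (suc j) v → box Q r j ≡ just v
        old (inj₁ Rrjv)           = from (Q-boxes r j v) Rrjv
        old (inj₂ (1+r≡1+x , _)) = contradiction (suc-injective 1+r≡1+x) r≢x
    ... | yes refl = subst (λ row → nth1 row (suc j) ≡ just v ⇔ R′ (suc r) (suc j) v)
                       (sym (rowAt-addAt x s Q)) (mk⇔ new-to new-from)
      where
        row = rowAt Q x
        new-to : nth1 (row ++ [ s ]) (suc j) ≡ just v → R′ (suc x) (suc j) v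
        new-to e with <-cmp j (length row)
        ... | tri< j< _ _  = inj₁ (to (Q-boxes x j v) (trans (sym (nth1-++ˡ row j<)) e))
        ... | tri≈ _ refl _ with trans (sym e) (nth1-++-length row s)
        ...   | refl = inj₂ (refl , cong suc row-length , refl)
        new-to e | tri> _ _ <j with trans (sym e) (nth1-++ʳ row <j)
        ... | ()
        new-from : R′ (suc x) (suc j) v → nth1 (row ++ [ s ]) (suc j) ≡ just v
        new-from (inj₁ Rxjv) = let e = from (Q-boxes x j v) Rxjv in
                               trans (nth1-++ˡ row (nth1-<length row j e)) e
        new-from (inj₂ (_ , refl , refl)) =
          subst (λ l → nth1 (row ++ [ s ]) (suc l) ≡ just s) row-length (nth1-++-length row s)

    step-invariant : RSKInvariant h′ R′ (rskStep s (P , Q) (suc x))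
    step-invariant = subst (RSKInvariant h′ R′) (sym (cong (λ (P′ , r) → P′ , addAt r s Q) insertion)) (record
      { fuel        = fuel + suc x
      ; fuel-bound  = []≔-All k≤length (m≤n+m (suc x) fuel)
                        (All.map (λ ≤F → ≤-trans ≤F (m≤m+n fuel (suc x))) fuel-bound)
      ; h-positive  = []≔-All k≤length z<s h-positive
      ; P-staircase = refl
      ; Q-shape     = shape
      ; Q-boxes     = boxes
      })
      where
        k≤length : k ≤ length h
        k≤length = exceeding-within h exceeds

RSKInvariant-⇔ : ∀ {h R R′ PQ} → (∀ i j v → R i j v ⇔ R′ i j v) →
                 RSKInvariant h R PQ → RSKInvariant h R′ PQ
RSKInvariant-⇔ R⇔R′ I = record
  { fuel = fuel ; fuel-bound = fuel-bound ; h-positive = h-positive ; P-staircase = P-staircase ; Q-shape = Q-shape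
  ; Q-boxes = λ r j v → ⇔-trans (Q-boxes r j v) (R⇔R′ _ _ v) }
  where open RSKInvariant I

RSKInvariant-empty : ∀ {R} → (∀ i j v → ¬ R i j v) → RSKInvariant [] R ([] , [])
RSKInvariant-empty ¬R = record
  { fuel = 0 ; fuel-bound = [] ; h-positive = [] ; P-staircase = refl
  ; Q-shape = λ r j → mk⇔ (λ ()) (λ ())
  ; Q-boxes = λ r j v → mk⇔ (λ ()) (⊥-elim ∘ ¬R _ _ v) }

rskFrom-∷ : ∀ s P Q x w →
  rskFrom s P Q (x ∷ w) ≡ rskFrom (suc s) (proj₁ (insertP x P)) (addAt (proj₂ (insertP x P)) s Q) w
rskFrom-∷ s P Q x w with insertP x P
... | _ = refl

rskFrom-∷ʳ : ∀ w s P Q x → rskFrom s P Q (w ∷ʳ x) ≡ rskStep (s + length w) (rskFrom s P Q w) x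
rskFrom-∷ʳ []      s P Q x =
  trans (rskFrom-∷ s P Q x []) (cong (λ s′ → rskStep s′ (P , Q) x) (sym (+-identityʳ s)))
rskFrom-∷ʳ (y ∷ w) s P Q x = begin
  rskFrom s P Q (y ∷ w ∷ʳ x)                             ≡⟨ rskFrom-∷ s P Q y (w ∷ʳ x) ⟩
  rskFrom (suc s) P′ Q′ (w ∷ʳ x)                         ≡⟨ rskFrom-∷ʳ w (suc s) P′ Q′ x ⟩
  rskStep (suc s + length w) (rskFrom (suc s) P′ Q′ w) x
    ≡⟨ cong₂ (λ s′ PQ → rskStep s′ PQ x) (sym (+-suc s (length w))) (sym (rskFrom-∷ s P Q y w)) ⟩
  rskStep (s + length (y ∷ w)) (rskFrom s P Q (y ∷ w)) x ∎
  where
    open ≡-Reasoning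
    P′ = proj₁ (insertP y P)
    Q′ = addAt (proj₂ (insertP y P)) s Q

rsk : (ℕ → ℕ) → ℕ → Tableau × Tableau
rsk f t = rskFrom 1 [] [] (applyUpTo (f ∘ suc) t)

rsk-suc : ∀ f t → rsk f (suc t) ≡ rskStep (suc t) (rsk f t) (f (suc t))
rsk-suc f t = begin
  rskFrom 1 [] [] (applyUpTo (f ∘ suc) (suc t))      ≡⟨ cong (rskFrom 1 [] []) (applyUpTo-∷ʳ (f ∘ suc) t) ⟨
  rskFrom 1 [] [] (applyUpTo (f ∘ suc) t ∷ʳ f (suc t))
    ≡⟨ rskFrom-∷ʳ (applyUpTo (f ∘ suc) t) 1 [] [] (f (suc t)) ⟩
  rskStep (suc (length (applyUpTo (f ∘ suc) t))) (rsk f t) (f (suc t))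
    ≡⟨ cong (λ s → rskStep (suc s) (rsk f t) (f (suc t))) (length-applyUpTo (f ∘ suc) t) ⟩
  rskStep (suc t) (rsk f t) (f (suc t)) ∎
  where open ≡-Reasoning

recording-box : ∀ f t r j → entry (recording (applyUpTo (f ∘ suc) t)) (suc r) (suc j) ≡ box (proj₂ (rsk f t)) r j
recording-box f t r j with rskFrom 1 [] [] (applyUpTo (f ∘ suc) t)
... | _ , Q = entry-box Q r j

recording-boxes : ∀ {h R} f t → RSKInvariant h R (rsk f t) → ∀ r j v →
  entry (recording (applyUpTo (f ∘ suc) t)) (suc r) (suc j) ≡ just v ⇔ R (suc r) (suc j) v
recording-boxes f t I r j v =
  subst (λ e → e ≡ just v ⇔ _) (sym (recording-box f t r j)) (RSKInvariant.Q-boxes I r j v)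

-- The viewing and counting words

Seen≤ : ℕ → ℕ → ℕ → ℕ → Set
Seen≤ t i j v = TIs i j v × v ≤ t

Seen≤-suc : ∀ t i j v → Seen≤ (suc t) i j v ⇔ AddBox (Seen≤ t) (V (suc t)) (C (suc t)) (suc t) i j v
Seen≤-suc t i j v = mk⇔ split join
  where
    split : Seen≤ (suc t) i j v → AddBox (Seen≤ t) (V (suc t)) (C (suc t)) (suc t) i j v
    split (seen-at , v≤1+t) with m≤n⇒m<n∨m≡n v≤1+t
    ... | inj₁ v<1+t = inj₁ (seen-at , s≤s⁻¹ v<1+t)
    ... | inj₂ refl  = let _ , V≡i , C≡j = seen-at in inj₂ (sym V≡i , sym C≡j , refl)
    join : AddBox (Seen≤ t) (V (suc t)) (C (suc t)) (suc t) i j v → Seen≤ (suc t) i j v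
    join (inj₁ (seen-at , v≤t))  = seen-at , m≤n⇒m≤1+n v≤t
    join (inj₂ (refl , refl , refl)) = (z<s , refl , refl) , ≤-refl

¬Seen≤0 : ∀ i j v → ¬ Seen≤ 0 i j v
¬Seen≤0 i j v ((1≤v , _) , v≤0) = <⇒≱ 1≤v v≤0

ViewInvariant : ℕ → Set
ViewInvariant t = ∃ λ h → RSKInvariant h (Seen≤ t) (rsk V t) × (∀ r → rowLength (proj₂ (rsk V t)) r ≡ seen t (suc r))

view-invariant : ∀ t → ViewInvariant t
view-invariant zero = [] , RSKInvariant-empty ¬Seen≤0 , λ _ → refl
view-invariant (suc t) with view-invariant t | viewed-drops t
... | h , I , lengths | a , V≡ , drops =
  h′ , subst (RSKInvariant h′ (Seen≤ (suc t))) (sym (trans (rsk-suc V t) (cong (rskStep s PQ) V≡)))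
           (RSKInvariant-⇔ new-boxes (step-invariant s)) , lengths′
  where
    s = suc t
    PQ = rsk V t
    Q = proj₂ PQ
    k = seen t (suc a)
    open RSKInvariant I
    hk≡a : h ! k ≡ a
    hk≡a = ≤-antisym (≮⇒≥ λ a<hk → <-irrefl (sym (lengths a)) (from (Q-shape a k) a<hk))
                     (DropsAt-≤ drops refl λ j k<seen → to (Q-shape j k) (subst (k <_) (sym (lengths j)) k<seen))
    open InsertStep I hk≡a (DropsAt-below k λ j j<k →
      subst (_< h ! j) (sym hk≡a) (to (Q-shape a j) (subst (j <_) (sym (lengths a)) j<k)))
    new-boxes : ∀ i j v → AddBox (Seen≤ t) (suc a) (suc k) s i j v ⇔ Seen≤ s i j v
    new-boxes i j v = subst₂ (λ x y → AddBox (Seen≤ t) x y s i j v ⇔ Seen≤ s i j v)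
                        V≡ (trans (cong (seen s) V≡) (seen-viewed t V≡)) (⇔-sym (Seen≤-suc t i j v))
    lengths′ : ∀ r → rowLength (proj₂ (rsk V s)) r ≡ seen s (suc r)
    lengths′ r = begin
      rowLength (proj₂ (rsk V s)) r
        ≡⟨ cong (λ PQ → rowLength (proj₂ PQ) r) (trans (rsk-suc V t) (cong (rskStep s PQ) V≡)) ⟩
      rowLength (addAt (proj₂ (insertP (suc a) (proj₁ PQ))) s Q) r
        ≡⟨ cong (λ x → rowLength (addAt x s Q) r) inserted-row ⟩
      rowLength (addAt a s Q) r
        ≡⟨ new-length ⟩
      seen s (suc r) ∎
      where
        open ≡-Reasoning
        new-length : rowLength (addAt a s Q) r ≡ seen s (suc r)
        new-length with r ≟ a
        ... | yes refl = trans (row-length-x s) (sym (seen-viewed t V≡))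
        ... | no  r≢a  = trans (row-length-other s r≢a)
                           (trans (lengths r) (sym (seen-other t (suc r) λ e → r≢a (suc-injective (trans e V≡)))))

AddBox-flip : ∀ R i j v i′ j′ v′ → flip (AddBox R i j v) i′ j′ v′ ⇔ AddBox (flip R) j i v i′ j′ v′
AddBox-flip R i j v i′ j′ v′ = mk⇔ swap swap
  where
    swap : ∀ {A B C D : Set} → A ⊎ (B × C × D) → A ⊎ (C × B × D)
    swap (inj₁ a)           = inj₁ a
    swap (inj₂ (b , c , d)) = inj₂ (c , b , d)

CountInvariant : ℕ → Set
CountInvariant t = ∃ λ h → RSKInvariant h (flip (Seen≤ t)) (rsk C t) × (∀ j → h ! j ≡ seen t (suc j))

count-invariant : ∀ t → CountInvariant t
count-invariant zero = [] , RSKInvariant-empty (λ i j v → ¬Seen≤0 j i v) , λ _ → refl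
count-invariant (suc t) with count-invariant t | viewed-drops t
... | h , I , counts | a , V≡ , drops =
  h′ , subst (RSKInvariant h′ (flip (Seen≤ s))) (sym (trans (rsk-suc C t) (cong (rskStep s (rsk C t)) C≡)))
         (RSKInvariant-⇔ new-boxes (step-invariant s)) , counts′
  where
    s = suc t
    k = seen t (suc a)
    C≡ : C s ≡ suc k
    C≡ = trans (cong (seen s) V≡) (seen-viewed t V≡)
    open InsertStep I (counts a) (DropsAt-cong (sym ∘ counts) drops)
    new-boxes : ∀ i j v → AddBox (flip (Seen≤ t)) (suc k) (suc a) s i j v ⇔ flip (Seen≤ s) i j v
    new-boxes i j v = subst₂ (λ x y → AddBox (flip (Seen≤ t)) y x s i j v ⇔ flip (Seen≤ s) i j v) V≡ C≡
                        (⇔-sym (⇔-trans (Seen≤-suc t j i v) (AddBox-flip (Seen≤ t) _ _ s i j v)))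
    counts′ : ∀ j → h′ ! j ≡ seen s (suc j)
    counts′ j with j ≟ a
    ... | yes refl = trans ([]≔-! h j (suc k)) (sym (seen-viewed t V≡))
    ... | no  j≢a  = trans ([]≔-!-other h a (suc k) j j≢a)
                       (trans (counts j) (sym (seen-other t (suc j) λ e → j≢a (suc-injective (trans e V≡)))))

mainTheorem9 : (t : ℕ) → 1 ≤ t →
    ((i j v : ℕ) → 1 ≤ i → 1 ≤ j →
      (entry (recording (viewWord t)) i j ≡ just v ⇔ (TIs i j v × v ≤ t)))
    × ((i j v : ℕ) → 1 ≤ i → 1 ≤ j →
      (entry (recording (countWord t)) j i ≡ just v ⇔ (TIs i j v × v ≤ t)))
mainTheorem9 t _ = view-part , count-part
  where
    view-part : (i j v : ℕ) → 1 ≤ i → 1 ≤ j → entry (recording (viewWord t)) i j ≡ just v ⇔ Seen≤ t i j v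
    view-part (suc r) (suc j) v _ _ = recording-boxes V t (proj₁ (proj₂ (view-invariant t))) r j v
    count-part : (i j v : ℕ) → 1 ≤ i → 1 ≤ j → entry (recording (countWord t)) j i ≡ just v ⇔ Seen≤ t i j v
    count-part (suc i) (suc r) v _ _ = recording-boxes C t (proj₁ (proj₂ (count-invariant t))) r i v
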